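{- Let $p$ be a prime and $\chi$ a Dirichlet character modulo $p$. (a) For every $1\le j\le p-1$, the number $\delta_\chi(j)\,\delta_{\overline\chi}(p-j)$ is purely imaginary if $\chi$ is odd, and real if $\chi$ is even. (b) If $\chi$ is odd, then $\sum_{j=1}^{p-1}\delta_\chi(j)\,\delta_{\overline\chi}(p-j)=0$.
   Context: The bar denotes complex conjugation; $\delta_\chi(n)=\sum_{0<d\mid n}\chi(d)$ for $n>0$. $\chi$ is odd if $\chi(-1)=-1$ and even if $\chi(-1)=1$. -}

module Defs where

open import Level using (Level; _⊔_) renaming (suc to lsuc)
open import Data.Nat as ℕ using (ℕ; zero; suc; _∸_)
open import Data.Nat.Divisibility using (_∣_; _∣?_)
open import Data.Integer as ℤ using (ℤ; +_; ∣_∣)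
open import Algebra.Bundles using (CommutativeRing)
open import Relation.Nullary using (¬_; yes; no)

pow : ∀ {c ℓ} (R : CommutativeRing c ℓ) → CommutativeRing.Carrier R → ℕ → CommutativeRing.Carrier R
pow R x zero = CommutativeRing.1# R
pow R x (suc n) = CommutativeRing._*_ R x (pow R x n)

-- An abstract model of the complex numbers with complex conjugation:
-- a commutative ring with an involutive ring automorphism `conj` such that
-- roots of unity are sent to their inverses (|ζ| = 1), and in which 2 is
-- cancellable (x + x = 0 ⇒ x = 0).  (ℂ with conjugation is an instance.)
record ConjRing (c ℓ : Level) : Set (lsuc (c ⊔ ℓ)) where
  field
    cring : CommutativeRing c ℓ
  open CommutativeRing cring public
  field
    conj        : Carrier → Carrier
    conj-cong   : ∀ {x y} → x ≈ y → conj x ≈ conj y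
    conj-+      : ∀ x y → conj (x + y) ≈ conj x + conj y
    conj-*      : ∀ x y → conj (x * y) ≈ conj x * conj y
    conj-1      : conj 1# ≈ 1#
    conj-invol  : ∀ x → conj (conj x) ≈ x
    conj-root   : ∀ (n : ℕ) x → pow cring x (suc n) ≈ 1# → x * conj x ≈ 1#
    two-cancel  : ∀ x → x + x ≈ 0# → x ≈ 0#

module _ {c ℓ : Level} (C : ConjRing c ℓ) where
  open ConjRing C

  record IsDirichletChar (p : ℕ) (χ : ℤ → Carrier) : Set (c ⊔ ℓ) where
    field
      periodic : ∀ a → χ (a ℤ.+ + p) ≈ χ a
      mult     : ∀ a b → χ (a ℤ.* b) ≈ χ a * χ b
      one      : χ (+ 1) ≈ 1#
      zero-val : ∀ a → p ∣ ∣ a ∣ → χ a ≈ 0#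
      nonzero  : ∀ a → ¬ (p ∣ ∣ a ∣) → ¬ (χ a ≈ 0#)

  conjChar : (ℤ → Carrier) → ℤ → Carrier
  conjChar χ a = conj (χ a)

  divSumUpTo : (ℤ → Carrier) → ℕ → ℕ → Carrier
  divSumUpTo χ n zero = 0#
  divSumUpTo χ n (suc k) with suc k ∣? n
  ... | yes _ = χ (+ suc k) + divSumUpTo χ n k
  ... | no  _ = divSumUpTo χ n k

  -- δ_χ(n) = Σ_{0 < d ∣ n} χ(d)   (used for n > 0)
  δ : (ℤ → Carrier) → ℕ → Carrier
  δ χ n = divSumUpTo χ n n

  sumFrom1 : ℕ → (ℕ → Carrier) → Carrier
  sumFrom1 zero f = 0#
  sumFrom1 (suc k) f = f (suc k) + sumFrom1 k f

  IsOdd IsEven : (ℤ → Carrier) → Set ℓ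
  IsOdd χ = χ (ℤ.- + 1) ≈ - 1#
  IsEven χ = χ (ℤ.- + 1) ≈ 1#

  IsReal IsPurelyImaginary : Carrier → Set ℓ
  IsReal z = conj z ≈ z
  IsPurelyImaginary z = conj z ≈ - z

{-# OPTIONS --safe #-}
module Submission where

-- For p ∤ n, pairing each divisor d of n with n / d and using χ(d) χ̄(d) = 1 gives
-- δ_χ̄(n) = χ̄(n) δ_χ(n).  Applied to j and p − j this yields
-- conj(δ_χ(j) δ_χ̄(p − j)) = χ̄(j) χ(p − j) δ_χ(j) δ_χ̄(p − j) = χ(−1) δ_χ(j) δ_χ̄(p − j),
-- which is (a).  For (b), the substitution j ↦ p − j shows that the sum equals its
-- conjugate, hence its negative when χ is odd, and 2 is cancellable.

open import Defs
open import Level using (Level)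
open import Data.Nat using (ℕ; _∸_; _≤_)
open import Data.Nat.Primality using (Prime)
open import Data.Integer using (ℤ)
open import Data.Product using (_×_)

open import Data.Nat as ℕ using (zero; suc; s≤s; z≤n; _<_; _^_; NonZero)
import Data.Nat.Properties as ℕₚ
open import Data.Nat.Divisibility using (_∣_; _∤_; _∣?_; divides; _∣0; ∣1⇒≡1; ∣⇒≤; ∣m⇒∣m*n)
open import Data.Nat.DivMod using (_%_; _/_; m≡m%n+[m/n]*n; m%n<n)
open import Data.Nat.Primality using (euclidsLemma; prime⇒nonZero; ¬prime[1])
import Data.Integer as ℤ
import Data.Integer.Properties as ℤₚ
open import Data.Fin using (Fin; toℕ; fromℕ<)
open import Data.Fin.Properties using (pigeonhole; toℕ-fromℕ<)
open import Data.Product using (∃; _,_)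
open import Data.Sum using (inj₁; inj₂)
open import Data.Empty using (⊥-elim)
open import Relation.Nullary using (Dec; yes; no)
open import Relation.Binary.PropositionalEquality as ≡ using (_≡_; _≢_)
import Algebra.Properties.Ring as RingProperties
import Algebra.Properties.CommutativeSemigroup as CommutativeSemigroupProperties

%-≡⇒∣∸ : ∀ {n} .{{_ : NonZero n}} x y → x % n ≡ y % n → n ∣ y ∸ x
%-≡⇒∣∸ {n} x y x%n≡y%n = divides (y / n ∸ x / n) (begin
  y ∸ x                                     ≡⟨ ≡.cong₂ _∸_ (m≡m%n+[m/n]*n y n) (m≡m%n+[m/n]*n x n) ⟩
  (y % n ℕ.+ qy) ∸ (x % n ℕ.+ qx)           ≡⟨ ≡.cong (λ r → (y % n ℕ.+ qy) ∸ (r ℕ.+ qx)) x%n≡y%n ⟩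
  (y % n ℕ.+ qy) ∸ (y % n ℕ.+ qx)           ≡⟨ ℕₚ.[m+n]∸[m+o]≡n∸o (y % n) qy qx ⟩
  qy ∸ qx                                   ≡⟨ ℕₚ.*-distribʳ-∸ n (y / n) (x / n) ⟨
  (y / n ∸ x / n) ℕ.* n                     ∎)
  where
  qx = x / n ℕ.* n
  qy = y / n ℕ.* n
  open ≡.≡-Reasoning

prime∣^⇒∣ : ∀ {p} → Prime p → ∀ b i → p ∣ b ^ i → p ∣ b
prime∣^⇒∣ pp b zero    p∣1 = ⊥-elim (¬prime[1] (≡.subst Prime (∣1⇒≡1 p∣1) pp))
prime∣^⇒∣ pp b (suc i) p∣b^1+i with euclidsLemma b (b ^ i) pp p∣b^1+i
... | inj₁ p∣b   = p∣b
... | inj₂ p∣b^i = prime∣^⇒∣ pp b i p∣b^i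

^-cancel-mod-prime : ∀ {p} .{{_ : NonZero p}} → Prime p → ∀ b .{{_ : NonZero b}} → p ∤ b →
                     ∀ i d → b ^ i % p ≡ b ^ (i ℕ.+ suc d) % p → ∃ λ t → b ^ suc d ≡ suc (t ℕ.* p)
^-cancel-mod-prime {p} pp b p∤b i d same-residue with euclidsLemma (b ^ i) (b ^ suc d ∸ 1) pp p∣bⁱ[bᵈ⁺¹∸1]
  where
  p∣bⁱ[bᵈ⁺¹∸1] : p ∣ b ^ i ℕ.* (b ^ suc d ∸ 1)
  p∣bⁱ[bᵈ⁺¹∸1] = ≡.subst (p ∣_)
    (≡.trans (≡.cong₂ _∸_ (ℕₚ.^-distribˡ-+-* b i (suc d)) (≡.sym (ℕₚ.*-identityʳ (b ^ i))))
             (≡.sym (ℕₚ.*-distribˡ-∸ (b ^ i) _ 1)))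
    (%-≡⇒∣∸ (b ^ i) (b ^ (i ℕ.+ suc d)) same-residue)
... | inj₁ p∣bⁱ = ⊥-elim (p∤b (prime∣^⇒∣ pp b i p∣bⁱ))
... | inj₂ (divides t bᵈ⁺¹∸1≡tp) = t , ≡.trans (≡.sym (ℕₚ.m+[n∸m]≡n (ℕₚ.m^n>0 b (suc d)))) (≡.cong suc bᵈ⁺¹∸1≡tp)

-- By pigeonhole two of b⁰, …, bᵖ agree modulo p.
prime∤⇒^≡1-mod : ∀ {p} → Prime p → ∀ b → p ∤ b → ∃ λ d → ∃ λ t → b ^ suc d ≡ suc (t ℕ.* p)
prime∤⇒^≡1-mod {p} pp zero      p∤0 = ⊥-elim (p∤0 (p ∣0))
prime∤⇒^≡1-mod {p} pp b@(suc _) p∤b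
  with pigeonhole (ℕₚ.n<1+n p) (λ (i : Fin (suc p)) → fromℕ< (m%n<n (b ^ toℕ i) p))
  where instance _ = prime⇒nonZero pp
... | i , j , i<j , same-residue = d , ^-cancel-mod-prime pp b p∤b (toℕ i) d bⁱ≡bʲ
  where
  instance _ = prime⇒nonZero pp
  d = toℕ j ∸ suc (toℕ i)
  bⁱ≡bʲ : b ^ toℕ i % p ≡ b ^ (toℕ i ℕ.+ suc d) % p
  bⁱ≡bʲ = begin
    b ^ toℕ i % p                ≡⟨ toℕ-fromℕ< _ ⟨
    toℕ (fromℕ< _)               ≡⟨ ≡.cong toℕ same-residue ⟩
    toℕ (fromℕ< _)               ≡⟨ toℕ-fromℕ< _ ⟩
    b ^ toℕ j % p                ≡⟨ ≡.cong (λ k → b ^ k % p) (ℕₚ.m+[n∸m]≡n i<j) ⟨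
    b ^ (suc (toℕ i) ℕ.+ d) % p  ≡⟨ ≡.cong (λ k → b ^ k % p) (ℕₚ.+-suc (toℕ i) d) ⟨
    b ^ (toℕ i ℕ.+ suc d) % p    ∎
    where open ≡.≡-Reasoning

module _ {c ℓ : Level} (C : ConjRing c ℓ) where
  open ConjRing C hiding (zero)
  open RingProperties ring using (-‿+-comm; -0#≈0#; x+x≈x⇒x≈0)
  open CommutativeSemigroupProperties +-commutativeSemigroup using ()
    renaming (interchange to +-interchange; x∙yz≈y∙xz to +-leftComm)
  open import Relation.Binary.Reasoning.Setoid setoid

  ∑ : ℕ → (ℕ → Carrier) → Carrier
  ∑ = sumFrom1 C

  ∑-cong : ∀ k {f g} → (∀ j → 1 ≤ j → j ≤ k → f j ≈ g j) → ∑ k f ≈ ∑ k g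
  ∑-cong zero    f≈g = refl
  ∑-cong (suc k) f≈g = +-cong (f≈g (suc k) (s≤s z≤n) ℕₚ.≤-refl)
                              (∑-cong k (λ j 1≤j j≤k → f≈g j 1≤j (ℕₚ.m≤n⇒m≤1+n j≤k)))

  ∑-zero : ∀ k → ∑ k (λ _ → 0#) ≈ 0#
  ∑-zero zero    = refl
  ∑-zero (suc k) = trans (+-identityˡ _) (∑-zero k)

  ∑-+ : ∀ k f g → ∑ k (λ j → f j + g j) ≈ ∑ k f + ∑ k g
  ∑-+ zero    f g = sym (+-identityʳ 0#)
  ∑-+ (suc k) f g = trans (+-cong refl (∑-+ k f g)) (+-interchange _ _ _ _)

  ∑-distribˡ : ∀ k x f → ∑ k (λ j → x * f j) ≈ x * ∑ k f
  ∑-distribˡ zero    x f = sym (zeroʳ x)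
  ∑-distribˡ (suc k) x f = trans (+-cong refl (∑-distribˡ k x f)) (sym (distribˡ x _ _))

  ∑-neg : ∀ k f → ∑ k (λ j → - f j) ≈ - ∑ k f
  ∑-neg zero    f = sym -0#≈0#
  ∑-neg (suc k) f = trans (+-cong refl (∑-neg k f)) (-‿+-comm _ _)

  ∑-comm : ∀ m k (g : ℕ → ℕ → Carrier) → ∑ m (λ a → ∑ k (g a)) ≈ ∑ k (λ b → ∑ m (λ a → g a b))
  ∑-comm zero    k g = sym (∑-zero k)
  ∑-comm (suc m) k g = trans (+-cong refl (∑-comm m k g)) (sym (∑-+ k (g (suc m)) _))

  ∑-suc : ∀ k f → ∑ (suc k) f ≈ f 1 + ∑ k (λ j → f (suc j))
  ∑-suc zero    f = refl
  ∑-suc (suc k) f = trans (+-cong refl (∑-suc k f)) (+-leftComm _ _ _)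

  ∑-reverse : ∀ k f → ∑ k f ≈ ∑ k (λ j → f (suc k ∸ j))
  ∑-reverse zero    f = refl
  ∑-reverse (suc k) f = begin
    ∑ (suc k) f                              ≈⟨ ∑-suc k f ⟩
    f 1 + ∑ k (λ j → f (suc j))              ≈⟨ +-cong refl (∑-reverse k (λ j → f (suc j))) ⟩
    f 1 + ∑ k (λ j → f (suc (suc k ∸ j)))    ≈⟨ +-cong (reflexive (≡.cong f (≡.sym (ℕₚ.m+n∸n≡m 1 k))))
                                                 (∑-cong k (λ j _ j≤k → reflexive (≡.cong f
                                                   (≡.sym (ℕₚ.+-∸-assoc 1 (ℕₚ.m≤n⇒m≤1+n j≤k)))))) ⟩
    ∑ (suc k) (λ j → f (suc (suc k) ∸ j))    ∎

  ifYes : {A : Set} → Dec A → Carrier → Carrier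
  ifYes (yes _) x = x
  ifYes (no _)  _ = 0#

  ifYes-cong : ∀ {A B : Set} (a? : Dec A) (b? : Dec B) {x y} →
               (A → B) → (B → A) → (A → x ≈ y) → ifYes a? x ≈ ifYes b? y
  ifYes-cong (yes a) (yes _) _   _   x≈y = x≈y a
  ifYes-cong (yes a) (no ¬b) A⇒B _   _   = ⊥-elim (¬b (A⇒B a))
  ifYes-cong (no ¬a) (yes b) _   B⇒A _   = ⊥-elim (¬a (B⇒A b))
  ifYes-cong (no _)  (no _)  _   _   _   = refl

  ifYes-* : ∀ {A : Set} (a? : Dec A) x y → ifYes a? (x * y) ≈ x * ifYes a? y
  ifYes-* (yes _) x y = refl
  ifYes-* (no _)  x y = sym (zeroʳ x)

  ∑-ifYes-*≡-none : ∀ a n m x → (∀ b → 1 ≤ b → b ≤ m → a ℕ.* b ≢ n) →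
                    ∑ m (λ b → ifYes (a ℕ.* b ℕ.≟ n) x) ≈ 0#
  ∑-ifYes-*≡-none a n zero    x none = refl
  ∑-ifYes-*≡-none a n (suc m) x none with a ℕ.* suc m ℕ.≟ n
  ... | yes ab≡n = ⊥-elim (none (suc m) (s≤s z≤n) ℕₚ.≤-refl ab≡n)
  ... | no  _    = trans (+-identityˡ _) (∑-ifYes-*≡-none a n m x (λ b 1≤b b≤m → none b 1≤b (ℕₚ.m≤n⇒m≤1+n b≤m)))

  ∑-ifYes-*≡-unique : ∀ a .{{_ : NonZero a}} n m x q → a ℕ.* q ≡ n → 1 ≤ q → q ≤ m →
                      ∑ m (λ b → ifYes (a ℕ.* b ℕ.≟ n) x) ≈ x
  ∑-ifYes-*≡-unique a n zero    x (suc _) _ _ ()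
  ∑-ifYes-*≡-unique a n (suc m) x q aq≡n 1≤q q≤1+m with a ℕ.* suc m ℕ.≟ n
  ... | yes a[1+m]≡n = trans (+-cong refl (∑-ifYes-*≡-none a n m x below-m)) (+-identityʳ x)
    where
    below-m : ∀ b → 1 ≤ b → b ≤ m → a ℕ.* b ≢ n
    below-m b _ b≤m ab≡n = ℕₚ.1+n≰n (≡.subst (_≤ m) (ℕₚ.*-cancelˡ-≡ b (suc m) a (≡.trans ab≡n (≡.sym a[1+m]≡n))) b≤m)
  ... | no a[1+m]≢n = trans (+-identityˡ _) (∑-ifYes-*≡-unique a n m x q aq≡n 1≤q q≤m)
    where
    q≤m : q ≤ m
    q≤m = ℕₚ.m<1+n⇒m≤n (ℕₚ.≤∧≢⇒< q≤1+m (λ q≡1+m → a[1+m]≢n (≡.subst (λ r → a ℕ.* r ≡ n) q≡1+m aq≡n)))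

  ∑-factorisations : ℕ → (ℕ → ℕ → Carrier) → Carrier
  ∑-factorisations n f = ∑ n (λ a → ∑ n (λ b → ifYes (a ℕ.* b ℕ.≟ n) (f a b)))

  ∑-factorisations-cong : ∀ n {f g} → (∀ a b → a ℕ.* b ≡ n → f a b ≈ g a b) →
                          ∑-factorisations n f ≈ ∑-factorisations n g
  ∑-factorisations-cong n f≈g =
    ∑-cong n (λ a _ _ → ∑-cong n (λ b _ _ → ifYes-cong (a ℕ.* b ℕ.≟ n) (a ℕ.* b ℕ.≟ n) (λ e → e) (λ e → e) (f≈g a b)))

  ∑-factorisations-distribˡ : ∀ n x f → ∑-factorisations n (λ a b → x * f a b) ≈ x * ∑-factorisations n f
  ∑-factorisations-distribˡ n x f = begin
    ∑-factorisations n (λ a b → x * f a b)                      ≈⟨ ∑-cong n (λ a _ _ → ∑-cong n (λ b _ _ → ifYes-* (a ℕ.* b ℕ.≟ n) x _)) ⟩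
    ∑ n (λ a → ∑ n (λ b → x * ifYes (a ℕ.* b ℕ.≟ n) (f a b)))  ≈⟨ ∑-cong n (λ a _ _ → ∑-distribˡ n x _) ⟩
    ∑ n (λ a → x * ∑ n (λ b → ifYes (a ℕ.* b ℕ.≟ n) (f a b)))  ≈⟨ ∑-distribˡ n x _ ⟩
    x * ∑-factorisations n f                                     ∎

  ∑-factorisations-swap : ∀ n f → ∑-factorisations n f ≈ ∑-factorisations n (λ a b → f b a)
  ∑-factorisations-swap n f = trans (∑-comm n n _)
    (∑-cong n (λ b _ _ → ∑-cong n (λ a _ _ →
      ifYes-cong (a ℕ.* b ℕ.≟ n) (b ℕ.* a ℕ.≟ n) (≡.trans (ℕₚ.*-comm b a)) (≡.trans (ℕₚ.*-comm a b)) (λ _ → refl))))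

  δ-∑-factorisations : ∀ ψ n → 1 ≤ n → δ C ψ n ≈ ∑-factorisations n (λ a _ → ψ (ℤ.+ a))
  δ-∑-factorisations ψ n 1≤n = divSumUpTo≈ n
    where
    divSumUpTo≈ : ∀ k → divSumUpTo C ψ n k ≈ ∑ k (λ a → ∑ n (λ b → ifYes (a ℕ.* b ℕ.≟ n) (ψ (ℤ.+ a))))
    divSumUpTo≈ zero = refl
    divSumUpTo≈ (suc k) with suc k ∣? n
    ... | yes (divides zero n≡0) = ⊥-elim (ℕₚ.<⇒≱ 1≤n (ℕₚ.≤-reflexive n≡0))
    ... | yes (divides q@(suc _) n≡q[1+k]) = +-cong
      (sym (∑-ifYes-*≡-unique (suc k) n n _ q (≡.trans (ℕₚ.*-comm (suc k) q) (≡.sym n≡q[1+k])) (s≤s z≤n)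
                              (≡.subst (q ≤_) (≡.sym n≡q[1+k]) (ℕₚ.m≤m*n q (suc k)))))
      (divSumUpTo≈ k)
    ... | no 1+k∤n = trans (sym (+-identityˡ _)) (+-cong (sym (∑-ifYes-*≡-none (suc k) n n _ no-cofactor)) (divSumUpTo≈ k))
      where
      no-cofactor : ∀ b → 1 ≤ b → b ≤ n → suc k ℕ.* b ≢ n
      no-cofactor b _ _ [1+k]b≡n = 1+k∤n (divides b (≡.trans (≡.sym [1+k]b≡n) (ℕₚ.*-comm (suc k) b)))

  -- Pairing each divisor a of n with its complement b = n / a.
  δ-complementary : ∀ ψ φ n x → 1 ≤ n → (∀ a b → a ℕ.* b ≡ n → ψ (ℤ.+ a) ≈ x * φ (ℤ.+ b)) →
                    δ C ψ n ≈ x * δ C φ n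
  δ-complementary ψ φ n x 1≤n ψa≈xφb = begin
    δ C ψ n                                             ≈⟨ δ-∑-factorisations ψ n 1≤n ⟩
    ∑-factorisations n (λ a _ → ψ (ℤ.+ a))              ≈⟨ ∑-factorisations-cong n ψa≈xφb ⟩
    ∑-factorisations n (λ _ b → x * φ (ℤ.+ b))          ≈⟨ ∑-factorisations-distribˡ n x _ ⟩
    x * ∑-factorisations n (λ _ b → φ (ℤ.+ b))          ≈⟨ *-cong refl (∑-factorisations-swap n _) ⟩
    x * ∑-factorisations n (λ a _ → φ (ℤ.+ a))          ≈⟨ *-cong refl (δ-∑-factorisations φ n 1≤n) ⟨
    x * δ C φ n                                         ∎

  conj-0# : conj 0# ≈ 0#
  conj-0# = x+x≈x⇒x≈0 (conj 0#) (trans (sym (conj-+ 0# 0#)) (conj-cong (+-identityʳ 0#)))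

  conj-divSumUpTo : ∀ ψ n k → conj (divSumUpTo C ψ n k) ≈ divSumUpTo C (conjChar C ψ) n k
  conj-divSumUpTo ψ n zero = conj-0#
  conj-divSumUpTo ψ n (suc k) with suc k ∣? n
  ... | yes _ = trans (conj-+ _ _) (+-cong refl (conj-divSumUpTo ψ n k))
  ... | no  _ = conj-divSumUpTo ψ n k

  divSumUpTo-cong : ∀ {ψ φ} n k → (∀ a → ψ a ≈ φ a) → divSumUpTo C ψ n k ≈ divSumUpTo C φ n k
  divSumUpTo-cong n zero    ψ≈φ = refl
  divSumUpTo-cong n (suc k) ψ≈φ with suc k ∣? n
  ... | yes _ = +-cong (ψ≈φ _) (divSumUpTo-cong n k ψ≈φ)
  ... | no  _ = divSumUpTo-cong n k ψ≈φ

  conj-δ-conjChar : ∀ ψ n → conj (δ C (conjChar C ψ) n) ≈ δ C ψ n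
  conj-δ-conjChar ψ n = trans (conj-divSumUpTo _ n n) (divSumUpTo-cong n n (λ a → conj-invol (ψ a)))

  module _ {p} (pp : Prime p) {χ : ℤ → Carrier} (isChar : IsDirichletChar C p χ) where
    open IsDirichletChar isChar
    open RingProperties ring using (-1*x≈-x)
    open CommutativeSemigroupProperties *-commutativeSemigroup using ()
      renaming (interchange to *-interchange; x∙yz≈y∙xz to *-leftComm)

    private
      χ̄ : ℤ → Carrier
      χ̄ = conjChar C χ

      χ-cong : ∀ {a b} → a ≡ b → χ a ≈ χ b
      χ-cong a≡b = reflexive (≡.cong χ a≡b)

      1+[p∸1]≡p : suc (p ∸ 1) ≡ p
      1+[p∸1]≡p = ℕₚ.m+[n∸m]≡n (ℕ.>-nonZero⁻¹ p {{prime⇒nonZero pp}})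

    χ-ℕ-* : ∀ a b → χ (ℤ.+ (a ℕ.* b)) ≈ χ (ℤ.+ a) * χ (ℤ.+ b)
    χ-ℕ-* a b = trans (χ-cong (ℤₚ.pos-* a b)) (mult (ℤ.+ a) (ℤ.+ b))

    χ-+-multiple : ∀ r t → χ (ℤ.+ (r ℕ.+ t ℕ.* p)) ≈ χ (ℤ.+ r)
    χ-+-multiple r zero    = χ-cong (≡.cong ℤ.+_ (ℕₚ.+-identityʳ r))
    χ-+-multiple r (suc t) = trans (χ-cong r+[p+tp]≡[r+tp]+p) (trans (periodic _) (χ-+-multiple r t))
      where
      r+[p+tp]≡[r+tp]+p : ℤ.+ (r ℕ.+ (p ℕ.+ t ℕ.* p)) ≡ ℤ.+ (r ℕ.+ t ℕ.* p) ℤ.+ ℤ.+ p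
      r+[p+tp]≡[r+tp]+p = ≡.trans (≡.cong ℤ.+_ (≡.trans (≡.cong (r ℕ.+_) (ℕₚ.+-comm p _)) (≡.sym (ℕₚ.+-assoc r _ p))))
                                  (ℤₚ.pos-+ (r ℕ.+ t ℕ.* p) p)

    pow-χ : ∀ b n → pow cring (χ (ℤ.+ b)) n ≈ χ (ℤ.+ (b ^ n))
    pow-χ b zero    = sym one
    pow-χ b (suc n) = trans (*-cong refl (pow-χ b n)) (sym (χ-ℕ-* b (b ^ n)))

    -- χ(b) is a root of unity, so conj-root applies.
    χ*χ̄≈1 : ∀ b → p ∤ b → χ (ℤ.+ b) * χ̄ (ℤ.+ b) ≈ 1#
    χ*χ̄≈1 b p∤b with prime∤⇒^≡1-mod pp b p∤b
    ... | d , t , bᵈ⁺¹≡1+tp = conj-root d (χ (ℤ.+ b)) (begin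
      pow cring (χ (ℤ.+ b)) (suc d)   ≈⟨ pow-χ b (suc d) ⟩
      χ (ℤ.+ (b ^ suc d))             ≈⟨ χ-cong (≡.cong ℤ.+_ bᵈ⁺¹≡1+tp) ⟩
      χ (ℤ.+ (1 ℕ.+ t ℕ.* p))         ≈⟨ χ-+-multiple 1 t ⟩
      χ (ℤ.+ 1)                       ≈⟨ one ⟩
      1#                              ∎)

    χ̄*χ≈1 : ∀ b → p ∤ b → χ̄ (ℤ.+ b) * χ (ℤ.+ b) ≈ 1#
    χ̄*χ≈1 b p∤b = trans (*-comm _ _) (χ*χ̄≈1 b p∤b)

    χ-p∸ : ∀ j → j ≤ p → χ (ℤ.+ (p ∸ j)) ≈ χ (ℤ.- ℤ.+ 1) * χ (ℤ.+ j)
    χ-p∸ j j≤p = begin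
      χ (ℤ.+ (p ∸ j))                 ≈⟨ χ-cong p∸j≡-j+p ⟩
      χ (ℤ.- ℤ.+ j ℤ.+ ℤ.+ p)         ≈⟨ periodic _ ⟩
      χ (ℤ.- ℤ.+ j)                   ≈⟨ χ-cong (ℤₚ.-1*i≡-i (ℤ.+ j)) ⟨
      χ (ℤ.- ℤ.+ 1 ℤ.* ℤ.+ j)         ≈⟨ mult _ _ ⟩
      χ (ℤ.- ℤ.+ 1) * χ (ℤ.+ j)       ∎
      where
      p∸j≡-j+p : ℤ.+ (p ∸ j) ≡ ℤ.- ℤ.+ j ℤ.+ ℤ.+ p
      p∸j≡-j+p = ≡.trans (≡.sym (ℤₚ.⊖-≥ j≤p)) (≡.trans (≡.sym (ℤₚ.m-n≡m⊖n p j)) (ℤₚ.+-comm (ℤ.+ p) (ℤ.- ℤ.+ j)))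

    δ-conjChar : ∀ n → 1 ≤ n → p ∤ n → δ C χ̄ n ≈ χ̄ (ℤ.+ n) * δ C χ n
    δ-conjChar n 1≤n p∤n = δ-complementary χ̄ χ n _ 1≤n λ a b ab≡n → sym (begin
      χ̄ (ℤ.+ n) * χ (ℤ.+ b)                     ≈⟨ *-cong (conj-cong (trans (χ-cong (≡.cong ℤ.+_ (≡.sym ab≡n))) (χ-ℕ-* a b))) refl ⟩
      conj (χ (ℤ.+ a) * χ (ℤ.+ b)) * χ (ℤ.+ b)  ≈⟨ *-cong (conj-* _ _) refl ⟩
      (χ̄ (ℤ.+ a) * χ̄ (ℤ.+ b)) * χ (ℤ.+ b)       ≈⟨ *-assoc _ _ _ ⟩
      χ̄ (ℤ.+ a) * (χ̄ (ℤ.+ b) * χ (ℤ.+ b))       ≈⟨ *-cong refl (χ̄*χ≈1 b (p∤b a b ab≡n)) ⟩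
      χ̄ (ℤ.+ a) * 1#                            ≈⟨ *-identityʳ _ ⟩
      χ̄ (ℤ.+ a)                                 ∎)
      where
      p∤b : ∀ a b → a ℕ.* b ≡ n → p ∤ b
      p∤b a b ab≡n p∣b = p∤n (≡.subst (p ∣_) (≡.trans (ℕₚ.*-comm b a) ab≡n) (∣m⇒∣m*n a p∣b))

    δ≈χ*δ-conjChar : ∀ n → 1 ≤ n → p ∤ n → δ C χ n ≈ χ (ℤ.+ n) * δ C χ̄ n
    δ≈χ*δ-conjChar n 1≤n p∤n = sym (begin
      χ (ℤ.+ n) * δ C χ̄ n                     ≈⟨ *-cong refl (δ-conjChar n 1≤n p∤n) ⟩
      χ (ℤ.+ n) * (χ̄ (ℤ.+ n) * δ C χ n)       ≈⟨ *-assoc _ _ _ ⟨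
      (χ (ℤ.+ n) * χ̄ (ℤ.+ n)) * δ C χ n       ≈⟨ *-cong (χ*χ̄≈1 n p∤n) refl ⟩
      1# * δ C χ n                            ≈⟨ *-identityˡ _ ⟩
      δ C χ n                                 ∎)

    δ-product : ℕ → Carrier
    δ-product j = δ C χ j * δ C χ̄ (p ∸ j)

    conj-δ-product : ∀ j → conj (δ-product j) ≈ δ C χ̄ j * δ C χ (p ∸ j)
    conj-δ-product j = trans (conj-* _ _) (*-cong (conj-divSumUpTo χ j j) (conj-δ-conjChar χ (p ∸ j)))

    conj-δ-product≈χ[-1]* : ∀ j → 1 ≤ j → j < p → conj (δ-product j) ≈ χ (ℤ.- ℤ.+ 1) * δ-product j
    conj-δ-product≈χ[-1]* j 1≤j j<p = begin
      conj (δ-product j)                                          ≈⟨ conj-δ-product j ⟩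
      δ C χ̄ j * δ C χ (p ∸ j)                                     ≈⟨ *-cong (δ-conjChar j 1≤j p∤j)
                                                                       (δ≈χ*δ-conjChar (p ∸ j) 1≤p∸j p∤p∸j) ⟩
      (χ̄ (ℤ.+ j) * δ C χ j) * (χ (ℤ.+ (p ∸ j)) * δ C χ̄ (p ∸ j)) ≈⟨ *-interchange _ _ _ _ ⟩
      (χ̄ (ℤ.+ j) * χ (ℤ.+ (p ∸ j))) * δ-product j                ≈⟨ *-cong (*-cong refl (χ-p∸ j (ℕₚ.<⇒≤ j<p))) refl ⟩
      (χ̄ (ℤ.+ j) * (χ (ℤ.- ℤ.+ 1) * χ (ℤ.+ j))) * δ-product j    ≈⟨ *-cong (*-leftComm _ _ _) refl ⟩
      (χ (ℤ.- ℤ.+ 1) * (χ̄ (ℤ.+ j) * χ (ℤ.+ j))) * δ-product j    ≈⟨ *-cong (*-cong refl (χ̄*χ≈1 j p∤j)) refl ⟩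
      (χ (ℤ.- ℤ.+ 1) * 1#) * δ-product j                          ≈⟨ *-cong (*-identityʳ _) refl ⟩
      χ (ℤ.- ℤ.+ 1) * δ-product j                                 ∎
      where
      p∤ : ∀ m → 1 ≤ m → m < p → p ∤ m
      p∤ (suc _) _ m<p p∣m = ℕₚ.<⇒≱ m<p (∣⇒≤ p∣m)
      p∤j = p∤ j 1≤j j<p
      1≤p∸j = ℕₚ.m<n⇒0<n∸m j<p
      p∤p∸j = p∤ (p ∸ j) 1≤p∸j (ℕₚ.∸-monoʳ-< 1≤j (ℕₚ.<⇒≤ j<p))

    ≤p∸1⇒< : ∀ {j} → j ≤ p ∸ 1 → j < p
    ≤p∸1⇒< j≤p∸1 = ≡.subst (suc _ ≤_) 1+[p∸1]≡p (s≤s j≤p∸1)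

    odd⇒δ-product-purelyImaginary : IsOdd C χ → ∀ j → 1 ≤ j → j ≤ p ∸ 1 → IsPurelyImaginary C (δ-product j)
    odd⇒δ-product-purelyImaginary odd j 1≤j j≤p∸1 =
      trans (conj-δ-product≈χ[-1]* j 1≤j (≤p∸1⇒< j≤p∸1)) (trans (*-cong odd refl) (-1*x≈-x _))

    even⇒δ-product-real : IsEven C χ → ∀ j → 1 ≤ j → j ≤ p ∸ 1 → IsReal C (δ-product j)
    even⇒δ-product-real even j 1≤j j≤p∸1 =
      trans (conj-δ-product≈χ[-1]* j 1≤j (≤p∸1⇒< j≤p∸1)) (trans (*-cong even refl) (*-identityˡ _))

    δ-product-p∸ : ∀ j → j ≤ p → δ-product (p ∸ j) ≈ conj (δ-product j)
    δ-product-p∸ j j≤p = begin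
      δ C χ (p ∸ j) * δ C χ̄ (p ∸ (p ∸ j))   ≈⟨ *-cong refl (reflexive (≡.cong (δ C χ̄) (ℕₚ.m∸[m∸n]≡n j≤p))) ⟩
      δ C χ (p ∸ j) * δ C χ̄ j               ≈⟨ *-comm _ _ ⟩
      δ C χ̄ j * δ C χ (p ∸ j)               ≈⟨ conj-δ-product j ⟨
      conj (δ-product j)                    ∎

    odd⇒∑-δ-product≈0 : IsOdd C χ → ∑ (p ∸ 1) δ-product ≈ 0#
    odd⇒∑-δ-product≈0 odd = two-cancel s (trans (+-cong refl s≈-s) (-‿inverseʳ s))
      where
      s = ∑ (p ∸ 1) δ-product
      s≈-s : s ≈ - s
      s≈-s = begin
        s                                                  ≈⟨ ∑-reverse (p ∸ 1) δ-product ⟩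
        ∑ (p ∸ 1) (λ j → δ-product (suc (p ∸ 1) ∸ j))      ≈⟨ ∑-cong (p ∸ 1) (λ j 1≤j j≤p∸1 → begin
            δ-product (suc (p ∸ 1) ∸ j)    ≈⟨ reflexive (≡.cong (λ m → δ-product (m ∸ j)) 1+[p∸1]≡p) ⟩
            δ-product (p ∸ j)              ≈⟨ δ-product-p∸ j (ℕₚ.<⇒≤ (≤p∸1⇒< j≤p∸1)) ⟩
            conj (δ-product j)             ≈⟨ odd⇒δ-product-purelyImaginary odd j 1≤j j≤p∸1 ⟩
            - δ-product j                  ∎) ⟩
        ∑ (p ∸ 1) (λ j → - δ-product j)                    ≈⟨ ∑-neg (p ∸ 1) δ-product ⟩
        - s                                                ∎

proposition5 : ∀ {c ℓ : Level} (C : ConjRing c ℓ) (p : ℕ) → Prime p →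
    (χ : ℤ → ConjRing.Carrier C) → IsDirichletChar C p χ →
    ((j : ℕ) → 1 ≤ j → j ≤ p ∸ 1 →
      (IsOdd C χ → IsPurelyImaginary C (ConjRing._*_ C (δ C χ j) (δ C (conjChar C χ) (p ∸ j))))
      × (IsEven C χ → IsReal C (ConjRing._*_ C (δ C χ j) (δ C (conjChar C χ) (p ∸ j)))))
    × (IsOdd C χ →
      ConjRing._≈_ C (sumFrom1 C (p ∸ 1) (λ j → ConjRing._*_ C (δ C χ j) (δ C (conjChar C χ) (p ∸ j)))) (ConjRing.0# C))
proposition5 C p pp χ isChar =
    (λ j 1≤j j≤p∸1 → (λ odd → odd⇒δ-product-purelyImaginary C pp isChar odd j 1≤j j≤p∸1)
                   , (λ even → even⇒δ-product-real C pp isChar even j 1≤j j≤p∸1))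
  , odd⇒∑-δ-product≈0 C pp isChar
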